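{- Let $p$ be a prime and let $n,s,k$ be positive integers; put $b=p^n$. Then $$\frac{b^{k}}{n}\sum_{i=0}^{sn-1}p^{i}\in\mathbb{Z}\iff\frac{b}{n}\sum_{i=0}^{sn-1}p^{i}\in\mathbb{Z},$$ equivalently $\frac{p^{nk}(p^{sn}-1)}{n(p-1)}\in\mathbb{Z}\iff\frac{p^{n}(p^{sn}-1)}{n(p-1)}\in\mathbb{Z}$. -}

module Defs where

open import Data.Nat using (ℕ; zero; suc; _+_; _^_)

geomSum : ℕ → ℕ → ℕ
geomSum p zero = 0
geomSum p (suc m) = geomSum p m + p ^ m

module Submission where

--     n ∣ p ^ N * X  implies  n ∣ p ^ n * X            (for every exponent N),
--
-- If p ∤ n then n is coprime to p, so
-- the powers of p can be cancelled and n ∣ X.  If n = p * q, cancel one factor p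
-- to get q ∣ p ^ (N - 1) * X, apply the induction hypothesis to q < n, and
-- multiply back: n ∣ p ^ (1 + q) * X, where 1 + q ≤ n.
--
-- Conversely, raising the exponent always preserves divisibility, so both
-- directions of proposition2 follow, using (p ^ n) ^ k = p ^ (n * k) with n ≤ n * k.

open import Defs
open import Data.Nat using (ℕ; _*_; _^_; NonZero)
open import Data.Nat.Divisibility using (_∣_)
open import Data.Nat.Primality using (Prime)
open import Function.Bundles using (_⇔_)

open import Data.Nat using (zero; suc; _+_; _∸_; _≤_; _<_; NonTrivial; >-nonZero⁻¹; nonTrivial⇒n>1)
open import Data.Nat.Properties
open import Data.Nat.Divisibility
open import Data.Nat.Primality using (prime⇒irreducible; prime⇒nonTrivial; prime⇒nonZero)
open import Data.Nat.Coprimality using (Coprime; coprime-divisor)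
open import Data.Nat.Induction using (<-wellFounded)
open import Induction.WellFounded using (Acc; acc)
open import Data.Product using (_,_)
open import Data.Sum using (inj₁; inj₂)
open import Data.Empty using (⊥-elim)
open import Relation.Nullary using (¬_; yes; no)
open import Relation.Binary.PropositionalEquality
open import Function.Bundles using (mk⇔)

^-∣-^ : ∀ b {m o} → m ≤ o → b ^ m ∣ b ^ o
^-∣-^ b {m} {o} m≤o = divides (b ^ (o ∸ m)) (begin
  b ^ o                ≡⟨ cong (b ^_) (sym (m∸n+n≡m m≤o)) ⟩
  b ^ (o ∸ m + m)      ≡⟨ ^-distribˡ-+-* b (o ∸ m) m ⟩
  b ^ (o ∸ m) * b ^ m  ∎)
  where open ≡-Reasoning

raise-exponent : ∀ {d} b {m o} X → m ≤ o → d ∣ b ^ m * X → d ∣ b ^ o * X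
raise-exponent b X m≤o d∣ = ∣-trans d∣ (*-monoˡ-∣ X (^-∣-^ b m≤o))

¬∣⇒coprime : ∀ {p n} → Prime p → ¬ (p ∣ n) → Coprime n p
¬∣⇒coprime pp p∤n (d∣n , d∣p) with prime⇒irreducible pp d∣p
... | inj₁ d≡1 = d≡1
... | inj₂ refl = ⊥-elim (p∤n d∣n)

coprime-cancel-powers : ∀ {n c} → Coprime n c → ∀ N X → n ∣ c ^ N * X → n ∣ X
coprime-cancel-powers {n} n⊥c zero    X n∣ = subst (n ∣_) (*-identityˡ X) n∣
coprime-cancel-powers {n} {c} n⊥c (suc N) X n∣ =
  coprime-cancel-powers n⊥c N X (coprime-divisor n⊥c (subst (n ∣_) (*-assoc c (c ^ N) X) n∣))

suc-≤-* : ∀ {m} q .{{_ : NonZero q}} → 1 < m → suc q ≤ m * q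
suc-≤-* {m} q 1<m = begin
  1 + q      ≤⟨ +-monoˡ-≤ q (>-nonZero⁻¹ q) ⟩
  q + q      ≡⟨ cong (q +_) (sym (+-identityʳ q)) ⟩
  2 * q      ≤⟨ *-monoˡ-≤ q 1<m ⟩
  m * q      ∎
  where open ≤-Reasoning

absorb-powers : ∀ {p} → Prime p → ∀ n .{{_ : NonZero n}} → ∀ N X →
                n ∣ p ^ N * X → n ∣ p ^ n * X
absorb-powers {p} pp n = go n (<-wellFounded n)
  where
  instance
    p-nonTrivial : NonTrivial p
    p-nonTrivial = prime⇒nonTrivial pp

  go : ∀ n → Acc _<_ n → .{{_ : NonZero n}} → ∀ N X → n ∣ p ^ N * X → n ∣ p ^ n * X
  go n _ zero X n∣ = ∣n⇒∣m*n (p ^ n) (subst (n ∣_) (*-identityˡ X) n∣)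
  go n (acc rec) (suc N) X n∣ with p ∣? n
  ... | no p∤n = ∣n⇒∣m*n (p ^ n) (coprime-cancel-powers (¬∣⇒coprime pp p∤n) (suc N) X n∣)
  ... | yes p∣n = raise-exponent p X 1+q≤n n∣p^[1+q]X
    where
    q : ℕ
    q = quotient p∣n
    n≡p*q : n ≡ p * q
    n≡p*q = m∣n⇒n≡m*quotient p∣n
    instance
      q-nonZero : NonZero q
      q-nonZero = quotient≢0 p∣n
    1+q≤n : suc q ≤ n
    1+q≤n = subst (suc q ≤_) (sym n≡p*q) (suc-≤-* q (nonTrivial⇒n>1 p))
    q∣p^NX : q ∣ p ^ N * X
    q∣p^NX = *-cancelˡ-∣ p {{prime⇒nonZero pp}}
               (subst₂ _∣_ n≡p*q (*-assoc p (p ^ N) X) n∣)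
    n∣p^[1+q]X : n ∣ p ^ suc q * X
    n∣p^[1+q]X = subst₂ _∣_ (sym n≡p*q) (sym (*-assoc p (p ^ q) X))
                   (*-monoʳ-∣ p (go q (rec (quotient-< p∣n)) N X q∣p^NX))

proposition2 : (p n s k : ℕ) → Prime p → .{{_ : NonZero n}} → .{{_ : NonZero s}} → .{{_ : NonZero k}}
    → (n ∣ (p ^ n) ^ k * geomSum p (s * n)) ⇔ (n ∣ p ^ n * geomSum p (s * n))
proposition2 p n s k pp = mk⇔ lower raise
  where
  G : ℕ
  G = geomSum p (s * n)
  p^nk : (p ^ n) ^ k ≡ p ^ (n * k)
  p^nk = ^-*-assoc p n k
  lower : n ∣ (p ^ n) ^ k * G → n ∣ p ^ n * G
  lower n∣ = absorb-powers pp n (n * k) G (subst (λ t → n ∣ t * G) p^nk n∣)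
  raise : n ∣ p ^ n * G → n ∣ (p ^ n) ^ k * G
  raise n∣ = subst (λ t → n ∣ t * G) (sym p^nk) (raise-exponent p G (m≤m*n n k) n∣)
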